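{- Let $G=(V,E)$ be a graph with $n=|V|$, $m=|E|$, and fix integers $c\ge1$, $0\le k\le n$, $\ell>k$. Let ${\bf s}_G$ be the string associated to $G,c,\ell$ as in the context. If $G$ has a vertex cover of size $k$, then there exists a $c$-BLZ parsing of ${\bf s}_G$ of size $4n+6m+k+(c-1)\ell$.
   Context: Strings: for ${\bf s}=s_1\dots s_N$, ${\bf s}[i,j]=s_i\dots s_j$. A parsing of ${\bf s}$ is a partition into consecutive nonempty substrings (phrases); its size is the number of phrases. An LZ-parsing is a parsing in which every phrase ${\bf s}[a,e]$ either has length $1$, or is given together with a chosen source start $b$ with $1\le b\le a-1$ and ${\bf s}[b,b+(e-a)-1]={\bf s}[a,e-1]$ (overlap allowed); each position $a+t$, $0\le t\le e-a-1$, then has source position $b+(t\bmod(a-b))$. The hop-number of position $p$ is $0$ if $p$ is the last position of a phrase and $hop(q)+1$ otherwise, where $q$ is the source position of $p$. A $c$-BLZ parsing is an LZ-parsing in which every hop-number is at most $c$. Construction: $G$ is simple undirected with $V=\{v_1,\dots,v_n\}$, $E=\{e_1,\dots,e_m\}$; for each edge $e_i$ fix an ordering $(v_p,v_q)$ of its endpoints. Use pairwise distinct symbols $v_i,v_i',\#^v_i$ ($i\in[n]$), $e_i,\$_i,\#^e_i$ ($i\in[m]$), $\#^p_t$ ($t\in[n+m]$), $\#^{(i)}_\gamma$ ($1\le i\le c-1$, $1\le\gamma\le\ell$). $P=v_1\#^p_1\cdots v_n\#^p_n e_1\#^p_{n+1}\cdots e_m\#^p_{n+m}$; $X_i=v_i'v_i\#^v_i$,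 $X=X_1\cdots X_n$; for $e_i=(v_p,v_q)$, $Y_i=v_p'\,v_p\,e_i\,\$_i\,v_q'\,v_q\,e_i\,\$_i\,\#^e_i$, $Y=Y_1\cdots Y_m$; $\alpha^{(1)}=PXY$; $\beta^{(i)}=\alpha^{(i)}\#^{(i)}_1\cdots\alpha^{(i)}\#^{(i)}_\ell$, $\alpha^{(i+1)}=\alpha^{(i)}\beta^{(i)}$; ${\bf s}_G=\alpha^{(c)}$. -}

module Defs where

open import Data.Nat using (ℕ; zero; suc; _+_; _∸_; _≤_; _<_)
open import Data.Nat.DivMod using (_%_)
open import Data.Fin using (Fin; toℕ)
open import Data.Fin.Subset using (Subset; _∈_; ∣_∣)
open import Data.Product using (Σ; _×_; _,_; proj₁; proj₂)
open import Data.Sum using (_⊎_)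
open import Data.Nat.ListAction using (sum)
open import Data.List using (List; []; _∷_; _++_; [_]; length; map; concat; upTo; tabulate)
open import Data.List.Relation.Unary.All using (All)
open import Data.Maybe using (Maybe; just; nothing)
open import Relation.Binary.PropositionalEquality using (_≡_; _≢_)

-- 1-based lookup: at s p = just s_p for 1 ≤ p ≤ |s|, nothing otherwise.
at : {A : Set} → List A → ℕ → Maybe A
at []       _             = nothing
at (x ∷ xs) zero          = nothing
at (x ∷ xs) (suc zero)    = just x
at (x ∷ xs) (suc (suc p)) = at xs (suc p)

-- t mod d, for d ≥ 1 (the value for d = 0 is never used)
_modℕ_ : ℕ → ℕ → ℕ
t modℕ zero    = t
t modℕ (suc d) = t % suc d

-- A phrase is given by its length and its chosen source start
-- (the source is irrelevant for phrases of length 1).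
record Phrase : Set where
  constructor phrase
  field
    len : ℕ
    src : ℕ
open Phrase public

-- The phrases as triples (a , e , b): start a, end e, source start b,
-- when the first phrase starts at position a₀.
triples : ℕ → List Phrase → List (ℕ × ℕ × ℕ)
triples a₀ []       = []
triples a₀ (ph ∷ ps) = (a₀ , a₀ + len ph ∸ 1 , src ph) ∷ triples (a₀ + len ph) ps

IsParsing : {A : Set} → List A → List Phrase → Set
IsParsing s ps = All (λ ph → 1 ≤ len ph) ps × sum (map len ps) ≡ length s

LZPhrase : {A : Set} → List A → ℕ × ℕ × ℕ → Set
LZPhrase s (a , e , b) =
  e ≡ a ⊎ (1 ≤ b × b < a × (∀ t → t < e ∸ a → at s (b + t) ≡ at s (a + t)))

IsLZParsing : {A : Set} → List A → List Phrase → Set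
IsLZParsing s ps = IsParsing s ps × All (LZPhrase s) (triples 1 ps)

HopEqs : (ℕ → ℕ) → ℕ × ℕ × ℕ → Set
HopEqs h (a , e , b) =
  h e ≡ 0 × (∀ t → t < e ∸ a → h (a + t) ≡ suc (h (b + (t modℕ (a ∸ b)))))

-- For an LZ-parsing the hop-equations determine h uniquely on [1,N]
-- (sources precede their positions), so this says hop(p) ≤ c for all p.
IsBLZParsing : {A : Set} → ℕ → List A → List Phrase → Set
IsBLZParsing c s ps =
  IsLZParsing s ps ×
  Σ (ℕ → ℕ) (λ h → All (HopEqs h) (triples 1 ps) ×
                   (∀ p → 1 ≤ p → p ≤ length s → h p ≤ c))

-- Simple graphs with a fixed ordering (v_p , v_q) of each edge

record Graph (n m : ℕ) : Set where
  field
    edge      : Fin m → Fin n × Fin n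
    irrefl    : ∀ i → proj₁ (edge i) ≢ proj₂ (edge i)
    noMulti   : ∀ i j → proj₁ (edge i) ≡ proj₁ (edge j) → proj₂ (edge i) ≡ proj₂ (edge j) → i ≡ j
    noMulti'  : ∀ i j → proj₁ (edge i) ≡ proj₂ (edge j) → proj₂ (edge i) ≡ proj₁ (edge j) → i ≡ j
open Graph public

HasVertexCover : {n m : ℕ} → Graph n m → ℕ → Set
HasVertexCover {n} G k =
  Σ (Subset n) λ C → ∣ C ∣ ≡ k ×
    (∀ i → proj₁ (edge G i) ∈ C ⊎ proj₂ (edge G i) ∈ C)

-- The string s_G (vertex/edge indices are 0-based: v_{i+1} is vtx i)

data Sym : Set where
  vtx   : ℕ → Sym
  vtx'  : ℕ → Sym
  hashV : ℕ → Sym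
  edg   : ℕ → Sym
  dol   : ℕ → Sym
  hashE : ℕ → Sym
  hashP : ℕ → Sym
  hashL : ℕ → ℕ → Sym

module Construction {n m : ℕ} (G : Graph n m) (ℓ : ℕ) where

  Pstr : List Sym
  Pstr = concat (tabulate {n = n} (λ i → vtx (toℕ i) ∷ hashP (toℕ i) ∷ []))
      ++ concat (tabulate {n = m} (λ j → edg (toℕ j) ∷ hashP (n + toℕ j) ∷ []))

  Xstr : List Sym
  Xstr = concat (tabulate {n = n} (λ i → vtx' (toℕ i) ∷ vtx (toℕ i) ∷ hashV (toℕ i) ∷ []))

  Ystr-i : Fin m → List Sym
  Ystr-i j = vtx' p ∷ vtx p ∷ edg (toℕ j) ∷ dol (toℕ j)
           ∷ vtx' q ∷ vtx q ∷ edg (toℕ j) ∷ dol (toℕ j) ∷ hashE (toℕ j) ∷ []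
    where
    p = toℕ (proj₁ (edge G j))
    q = toℕ (proj₂ (edge G j))

  Ystr : List Sym
  Ystr = concat (tabulate Ystr-i)

  betaOf : ℕ → List Sym → List Sym
  betaOf i α = concat (map (λ γ → α ++ [ hashL i γ ]) (map suc (upTo ℓ)))

  -- alpha i = α^(i) for i ≥ 1 (alpha 0 is unused)
  alpha : ℕ → List Sym
  alpha zero          = []
  alpha (suc zero)    = Pstr ++ Xstr ++ Ystr
  alpha (suc (suc i)) = alpha (suc i) ++ betaOf (suc i) (alpha (suc i))

sG : {n m : ℕ} → Graph n m → (c ℓ : ℕ) → List Sym
sG G c ℓ = Construction.alpha G ℓ c

{-# OPTIONS --safe #-}
-- Each phrase is recorded as a factor: an earlier word of the string, annotated with the
-- hop-numbers of its letters, followed by one new letter. Writing the copied word back with every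
-- hop-number raised by one and the new letter at hop-number 0 annotates the whole string; when
-- every source lies strictly before its phrase, the annotation satisfies the hop equations, so the
-- parsing is c-BLZ once every annotation is at most c. In α⁽¹⁾ every phrase copies letters of
-- hop-number 0, so the annotations are at most 1. This is where the cover is needed: each Y_i copies
-- v'v from X for an endpoint v in the cover, and only covered vertices pay the extra phrase that
-- keeps v at hop-number 0 in X. Each block α⁽ⁱ⁾ #⁽ⁱ⁾_γ of β⁽ⁱ⁾ is one phrase copying α⁽ⁱ⁾, which
-- raises the bound by one per level.
module Submission where

open import Defs
open import Data.Bool using (Bool; true; false)
open import Data.Fin using (Fin; toℕ; zero; suc)
open import Data.Fin.Subset using (Subset; _∈_; ∣_∣)
open import Data.List using (List; []; _∷_; _++_; [_]; length; map; concat; concatMap; tabulate; upTo)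
open import Data.List.Properties
  using (length-++; length-map; length-upTo; ++-assoc; ++-identityʳ; map-++; map-∘; concatMap-++)
open import Data.List.Relation.Unary.All as All using (All; []; _∷_)
open import Data.List.Relation.Unary.All.Properties using (++⁺; concat⁺; map⁺; tabulate⁺)
open import Data.Maybe as Maybe using (just; maybe′)
open import Data.Maybe.Properties using () renaming (map-∘ to maybe-map-∘)
open import Data.Nat using (ℕ; zero; suc; _+_; _*_; _∸_; _≤_; _<_; z≤n; s≤s)
open import Data.Nat.DivMod using (m<n⇒m%n≡m)
open import Data.Nat.ListAction using (sum)
open import Data.Nat.Properties
open import Data.Nat.Tactic.RingSolver using (solve-∀)
open import Data.Product using (Σ; ∃₂; _×_; _,_; proj₁; proj₂; map₂)
open import Data.Sum using (_⊎_; inj₁; inj₂)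
open import Data.Unit using (⊤; tt)
open import Data.Vec using (lookup; []; _∷_)
open import Data.Vec.Properties using ([]=⇒lookup)
open import Function using (_∘_)
open import Relation.Binary.PropositionalEquality hiding ([_])

private variable
  A B I : Set

at-++ˡ : ∀ (U V : List A) {t} → t < length U → at (U ++ V) (suc t) ≡ at U (suc t)
at-++ˡ (u ∷ U) V {zero}  _         = refl
at-++ˡ (u ∷ U) V {suc t} (s≤s t<U) = at-++ˡ U V t<U

at-++ʳ : ∀ (U V : List A) t → at (U ++ V) (suc (length U + t)) ≡ at V (suc t)
at-++ʳ []      V t = refl
at-++ʳ (u ∷ U) V t = at-++ʳ U V t

at-map : ∀ (f : A → B) xs p → at (map f xs) p ≡ Maybe.map f (at xs p)
at-map f []       p             = refl
at-map f (x ∷ xs) zero          = refl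
at-map f (x ∷ xs) (suc zero)    = refl
at-map f (x ∷ xs) (suc (suc p)) = at-map f xs (suc p)

modℕ-small : ∀ {t d} → t < d → t modℕ d ≡ t
modℕ-small {d = suc d} t<d = m<n⇒m%n≡m t<d

m+[1+n]∸[1+m]≡n : ∀ m n → m + suc n ∸ suc m ≡ n
m+[1+n]∸[1+m]≡n m n = trans (cong (_∸ suc m) (+-suc m n)) (m+n∸m≡n (suc m) n)

length-concat-tabulate : ∀ {k L} (f : Fin k → List A) → (∀ i → length (f i) ≡ L) →
  length (concat (tabulate f)) ≡ L * k
length-concat-tabulate {k = zero}  {L} f len = sym (*-zeroʳ L)
length-concat-tabulate {k = suc k} {L} f len = begin
  length (f zero ++ concat (tabulate (f ∘ suc)))         ≡⟨ length-++ (f zero) ⟩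
  length (f zero) + length (concat (tabulate (f ∘ suc))) ≡⟨ cong₂ _+_ (len zero) (length-concat-tabulate (f ∘ suc) (len ∘ suc)) ⟩
  L + L * k                                              ≡⟨ sym (*-suc L k) ⟩
  L * suc k                                              ∎
  where open ≡-Reasoning

length-concat-tabulate-subset : ∀ {k L} (D : Subset k) (g : Bool → Fin k → List A) →
  (∀ i → length (g false i) ≡ L) → (∀ i → length (g true i) ≡ suc L) →
  length (concat (tabulate (λ i → g (lookup D i) i))) ≡ L * k + ∣ D ∣
length-concat-tabulate-subset {L = L} [] g len-out len-in = cong (_+ 0) (sym (*-zeroʳ L))
length-concat-tabulate-subset {k = suc k} {L} (b ∷ D) g len-out len-in =
  trans (length-++ (g b zero)) (count b)
  where
  rest = length-concat-tabulate-subset D (λ b → g b ∘ suc) (len-out ∘ suc) (len-in ∘ suc)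
  count : ∀ b → length (g b zero) + length (concat (tabulate (λ i → g (lookup D i) (suc i))))
                ≡ L * suc k + ∣ b ∷ D ∣
  count true  = trans (cong₂ _+_ (len-in zero) rest) (arith L k ∣ D ∣)
    where
    arith : ∀ L k d → suc L + (L * k + d) ≡ L * suc k + suc d
    arith = solve-∀
  count false = trans (cong₂ _+_ (len-out zero) rest) (arith L k ∣ D ∣)
    where
    arith : ∀ L k d → L + (L * k + d) ≡ L * suc k + d
    arith = solve-∀

OccursAt : List A → ℕ → List A → Set
OccursAt W k Z = ∃₂ λ U R → Z ≡ U ++ W ++ R × length U ≡ k

OccursBefore : List A → ℕ → ℕ → List A → Set
OccursBefore W k o Z = OccursAt W k Z × length W + k ≤ o

occurs-here : ∀ (W R : List A) → OccursAt W 0 (W ++ R)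
occurs-here W R = [] , R , refl , refl

occurs-++ˡ : ∀ (U : List A) {W k Z} → OccursAt W k Z → OccursAt W (length U + k) (U ++ Z)
occurs-++ˡ U (U′ , R , refl , refl) = U ++ U′ , R , sym (++-assoc U U′ _) , length-++ U

occurs-++ʳ : ∀ {W : List A} {k Z} (T : List A) → OccursAt W k Z → OccursAt W k (Z ++ T)
occurs-++ʳ {W = W} T (U , R , refl , refl) =
  U , R ++ T , trans (++-assoc U (W ++ R) T) (cong (U ++_) (++-assoc W R T)) , refl

occurs-trans : ∀ {V W Z : List A} {j k} → OccursAt V k Z → OccursAt W j V → OccursAt W (j + k) Z
occurs-trans {V = V} {W} {j = j} (U , R , refl , refl) inner =
  subst (λ i → OccursAt W i (U ++ V ++ R)) (+-comm (length U) j) (occurs-++ˡ U (occurs-++ʳ R inner))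

occurs-++⁻ : ∀ {V W Z : List A} {k} → OccursAt (V ++ W) k Z → OccursAt V k Z × OccursAt W (k + length V) Z
occurs-++⁻ {V = V} {W} (U , R , refl , refl) =
    (U , W ++ R , cong (U ++_) (++-assoc V W R) , refl)
  , (U ++ V , R , trans (cong (U ++_) (++-assoc V W R)) (sym (++-assoc U V (W ++ R))) , length-++ U)

occurs-length : ∀ {W Z : List A} {k} → OccursAt W k Z → length W + k ≤ length Z
occurs-length {W = W} (U , R , refl , refl) = begin
  length W + length U              ≤⟨ m≤m+n _ (length R) ⟩
  length W + length U + length R   ≡⟨ cong (_+ length R) (+-comm (length W) (length U)) ⟩
  length U + length W + length R   ≡⟨ +-assoc (length U) (length W) (length R) ⟩
  length U + (length W + length R) ≡⟨ cong (length U +_) (sym (length-++ W)) ⟩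
  length U + length (W ++ R)       ≡⟨ sym (length-++ U) ⟩
  length (U ++ W ++ R)             ∎
  where open ≤-Reasoning

at-occurs : ∀ {W Z : List A} {k t} → OccursAt W k Z → t < length W → at Z (suc (k + t)) ≡ at W (suc t)
at-occurs {W = W} {t = t} (U , R , refl , refl) t<W = trans (at-++ʳ U (W ++ R) t) (at-++ˡ W R t<W)

occurs-concat-tabulate : ∀ {k L} (f : Fin k → List A) → (∀ i → length (f i) ≡ L) →
  ∀ i → OccursAt (f i) (L * toℕ i) (concat (tabulate f))
occurs-concat-tabulate {L = L} f len zero =
  subst (λ o → OccursAt (f zero) o (concat (tabulate f))) (sym (*-zeroʳ L)) (occurs-here (f zero) _)
occurs-concat-tabulate {L = L} f len (suc i) =
  subst (λ o → OccursAt (f (suc i)) o (concat (tabulate f)))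
    (trans (cong (_+ L * toℕ i) (len zero)) (sym (*-suc L (toℕ i))))
    (occurs-++ˡ (f zero) (occurs-concat-tabulate (f ∘ suc) (len ∘ suc) i))

[]-occursBefore : ∀ {Z : List A} {o} → OccursBefore [] 0 o Z
[]-occursBefore {Z = Z} = ([] , Z , refl , refl) , z≤n

occursBefore-prefix : ∀ {Z Pre Rest W : List A} {k o} → Z ≡ Pre ++ Rest → OccursAt W k Pre →
  length Pre ≤ o → OccursBefore W k o Z
occursBefore-prefix refl occurs Pre≤o = occurs-++ʳ _ occurs , ≤-trans (occurs-length occurs) Pre≤o

HopsAtMost : ℕ → List (A × ℕ) → Set
HopsAtMost c = All (λ y → proj₂ y ≤ c)

hopAt : List (A × ℕ) → ℕ → ℕ
hopAt Z p = maybe′ proj₂ 0 (at Z p)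

hopAt-≤ : ∀ {c} (Z : List (A × ℕ)) → HopsAtMost c Z → ∀ p → hopAt Z p ≤ c
hopAt-≤ []      _        p             = z≤n
hopAt-≤ (y ∷ Z) _        zero          = z≤n
hopAt-≤ (y ∷ Z) (h ∷ _)  (suc zero)    = h
hopAt-≤ (y ∷ Z) (_ ∷ hs) (suc (suc p)) = hopAt-≤ Z hs (suc p)

hopAt-map-suc : ∀ (W : List (A × ℕ)) {t} → t < length W →
  hopAt (map (map₂ suc) W) (suc t) ≡ suc (hopAt W (suc t))
hopAt-map-suc (w ∷ W) {zero}  _         = refl
hopAt-map-suc (w ∷ W) {suc t} (s≤s t<W) = hopAt-map-suc W t<W

-- Letters are annotated with hop-numbers. A factor copies the annotated word `copy`, which starts
-- after `offset` letters (so its 1-based source start is `suc offset`), and then adds `final`.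
record Factor (A : Set) : Set where
  constructor factor
  field
    copy   : List (A × ℕ)
    final  : A
    offset : ℕ
open Factor

expand : Factor A → List (A × ℕ)
expand f = map (map₂ suc) (copy f) ++ [ (final f , 0) ]

expandAll : List (Factor A) → List (A × ℕ)
expandAll = concatMap expand

symbols : List (Factor A) → List A
symbols fs = map proj₁ (expandAll fs)

size : Factor A → ℕ
size f = suc (length (copy f))

toPhrase : Factor A → Phrase
toPhrase f = phrase (size f) (suc (offset f))

Valid : List (A × ℕ) → ℕ → Factor A → Set
Valid Z o f = OccursBefore (copy f) (offset f) o Z

AllValid : List (A × ℕ) → ℕ → List (Factor A) → Set
AllValid Z o []       = ⊤
AllValid Z o (f ∷ fs) = Valid Z o f × AllValid Z (size f + o) fs

length-expand : ∀ (f : Factor A) → length (expand f) ≡ size f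
length-expand f = trans (length-++ (map (map₂ suc) (copy f)))
  (trans (cong (_+ 1) (length-map (map₂ suc) (copy f))) (+-comm (length (copy f)) 1))

length-expandAll : ∀ (fs : List (Factor A)) → length (expandAll fs) ≡ sum (map len (map toPhrase fs))
length-expandAll []       = refl
length-expandAll (f ∷ fs) =
  trans (length-++ (expand f)) (cong₂ _+_ (length-expand f) (length-expandAll fs))

at-placed-copy : ∀ {Z : List (A × ℕ)} {o t} (f : Factor A) → OccursAt (expand f) o Z →
  t < length (copy f) → at Z (suc (o + t)) ≡ at (map (map₂ suc) (copy f)) (suc t)
at-placed-copy f placed t<w = trans
  (at-occurs placed (≤-trans (m≤n⇒m≤1+n t<w) (≤-reflexive (sym (length-expand f)))))
  (at-++ˡ (map (map₂ suc) (copy f)) _ (≤-trans t<w (≤-reflexive (sym (length-map (map₂ suc) (copy f))))))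

at-placed-final : ∀ {Z : List (A × ℕ)} {o} (f : Factor A) → OccursAt (expand f) o Z →
  at Z (o + size f) ≡ just (final f , 0)
at-placed-final {Z = Z} {o} f placed = begin
  at Z (o + suc w)            ≡⟨ cong (at Z) (+-suc o w) ⟩
  at Z (suc (o + w))          ≡⟨ at-occurs placed (≤-reflexive (sym (length-expand f))) ⟩
  at (expand f) (suc w)       ≡⟨ cong (at (expand f) ∘ suc) (sym (trans (+-identityʳ _) (length-map _ (copy f)))) ⟩
  at (copied ++ [ (final f , 0) ]) (suc (length copied + 0))
                              ≡⟨ at-++ʳ copied _ 0 ⟩
  just (final f , 0)          ∎
  where
  open ≡-Reasoning
  w = length (copy f)
  copied = map (map₂ suc) (copy f)

factor-LZPhrase : ∀ {Z : List (A × ℕ)} {o} (f : Factor A) → OccursAt (expand f) o Z → Valid Z o f →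
  LZPhrase (map proj₁ Z) (suc o , o + size f , suc (offset f))
factor-LZPhrase {o = o} (factor []      x k) placed valid = inj₁ (+-comm o 1)
factor-LZPhrase {Z = Z} {o} f@(factor (y ∷ W) x k) placed (source , ends-before) =
  inj₂ (s≤s z≤n , s≤s (≤-trans (s≤s (m≤n+m k (length W))) ends-before) , letters)
  where
  letters : ∀ t → t < o + size f ∸ suc o → at (map proj₁ Z) (suc k + t) ≡ at (map proj₁ Z) (suc o + t)
  letters t t<span = begin
    at (map proj₁ Z) (suc (k + t))                              ≡⟨ at-map proj₁ Z _ ⟩
    Maybe.map proj₁ (at Z (suc (k + t)))                        ≡⟨ cong (Maybe.map proj₁) (at-occurs source t<w) ⟩
    Maybe.map proj₁ (at (copy f) (suc t))                       ≡⟨ maybe-map-∘ (at (copy f) (suc t)) ⟩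
    Maybe.map proj₁ (Maybe.map (map₂ suc) (at (copy f) (suc t))) ≡⟨ cong (Maybe.map proj₁) (sym (at-map _ (copy f) (suc t))) ⟩
    Maybe.map proj₁ (at (map (map₂ suc) (copy f)) (suc t))      ≡⟨ cong (Maybe.map proj₁) (sym (at-placed-copy f placed t<w)) ⟩
    Maybe.map proj₁ (at Z (suc (o + t)))                        ≡⟨ sym (at-map proj₁ Z _) ⟩
    at (map proj₁ Z) (suc (o + t))                              ∎
    where
    open ≡-Reasoning
    t<w = subst (t <_) (m+[1+n]∸[1+m]≡n o (length (copy f))) t<span

factor-HopEqs : ∀ {Z : List (A × ℕ)} {o} (f : Factor A) → OccursAt (expand f) o Z → Valid Z o f →
  HopEqs (hopAt Z) (suc o , o + size f , suc (offset f))
factor-HopEqs {Z = Z} {o} f placed (source , ends-before) = cong (maybe′ proj₂ 0) (at-placed-final f placed) , hops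
  where
  k = offset f
  hops : ∀ t → t < o + size f ∸ suc o → hopAt Z (suc o + t) ≡ suc (hopAt Z (suc k + (t modℕ (o ∸ k))))
  hops t t<span = begin
    hopAt Z (suc (o + t))                       ≡⟨ cong (maybe′ proj₂ 0) (at-placed-copy f placed t<w) ⟩
    hopAt (map (map₂ suc) (copy f)) (suc t)     ≡⟨ hopAt-map-suc (copy f) t<w ⟩
    suc (hopAt (copy f) (suc t))                ≡⟨ cong (suc ∘ maybe′ proj₂ 0) (sym (at-occurs source t<w)) ⟩
    suc (hopAt Z (suc (k + t)))                 ≡⟨ cong (λ u → suc (hopAt Z (suc (k + u)))) (sym (modℕ-small t<o∸k)) ⟩
    suc (hopAt Z (suc (k + (t modℕ (o ∸ k)))))  ∎
    where
    open ≡-Reasoning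
    t<w = subst (t <_) (m+[1+n]∸[1+m]≡n o (length (copy f))) t<span
    -- the source ends before the phrase starts, so the `mod` of the hop equation is inert
    t<o∸k = ≤-trans t<w (m+n≤o⇒m≤o∸n (length (copy f)) ends-before)

PhraseConditions : List (A × ℕ) → ℕ × ℕ × ℕ → Set
PhraseConditions Z tr = LZPhrase (map proj₁ Z) tr × HopEqs (hopAt Z) tr

factors-conditions : ∀ {Z : List (A × ℕ)} {o} (fs : List (Factor A)) → OccursAt (expandAll fs) o Z →
  AllValid Z o fs → All (PhraseConditions Z) (triples (suc o) (map toPhrase fs))
factors-conditions []       _      _                = []
factors-conditions {Z = Z} {o} (f ∷ fs) placed (valid , valids) =
    (factor-LZPhrase f here valid , factor-HopEqs f here valid)
  ∷ factors-conditions fs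
      (subst (λ i → OccursAt (expandAll fs) i Z) (cong (o +_) (length-expand f)) rest)
      (subst (λ i → AllValid Z i fs) (+-comm (size f) o) valids)
  where
  here = proj₁ (occurs-++⁻ {V = expand f} placed)
  rest = proj₂ (occurs-++⁻ {V = expand f} placed)

isBLZParsing : ∀ c (fs : List (Factor A)) → AllValid (expandAll fs) 0 fs → HopsAtMost c (expandAll fs) →
  IsBLZParsing c (symbols fs) (map toPhrase fs)
isBLZParsing c fs valid hops =
  ((nonempty , covers) , proj₁ conditions) , hopAt Z , proj₂ conditions , λ p _ _ → hopAt-≤ Z hops p
  where
  Z = expandAll fs
  nonempty : All (λ ph → 1 ≤ len ph) (map toPhrase fs)
  nonempty = map⁺ (All.universal (λ _ → s≤s z≤n) fs)
  covers : sum (map len (map toPhrase fs)) ≡ length (symbols fs)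
  covers = trans (sym (length-expandAll fs)) (sym (length-map proj₁ Z))
  conditions = All.unzip (factors-conditions fs ([] , [] , sym (++-identityʳ Z) , refl) valid)

expandAll-++ : ∀ (fs gs : List (Factor A)) → expandAll (fs ++ gs) ≡ expandAll fs ++ expandAll gs
expandAll-++ = concatMap-++ expand

symbols-++ : ∀ (fs gs : List (Factor A)) → symbols (fs ++ gs) ≡ symbols fs ++ symbols gs
symbols-++ fs gs = trans (cong (map proj₁) (expandAll-++ fs gs)) (map-++ proj₁ (expandAll fs) (expandAll gs))

expandAll-concat-tabulate : ∀ {k} (g : Fin k → List (Factor A)) →
  expandAll (concat (tabulate g)) ≡ concat (tabulate (expandAll ∘ g))
expandAll-concat-tabulate {k = zero}  g = refl
expandAll-concat-tabulate {k = suc k} g =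
  trans (expandAll-++ (g zero) _) (cong (expandAll (g zero) ++_) (expandAll-concat-tabulate (g ∘ suc)))

symbols-concat-tabulate : ∀ {k} (g : Fin k → List (Factor A)) (h : Fin k → List A) →
  (∀ i → symbols (g i) ≡ h i) → symbols (concat (tabulate g)) ≡ concat (tabulate h)
symbols-concat-tabulate {k = zero}  g h eq = refl
symbols-concat-tabulate {k = suc k} g h eq =
  trans (symbols-++ (g zero) _) (cong₂ _++_ (eq zero) (symbols-concat-tabulate (g ∘ suc) (h ∘ suc) (eq ∘ suc)))

hops-concat-tabulate : ∀ {k c} (g : Fin k → List (Factor A)) →
  (∀ i → HopsAtMost c (expandAll (g i))) → HopsAtMost c (expandAll (concat (tabulate g)))
hops-concat-tabulate g hops =
  subst (HopsAtMost _) (sym (expandAll-concat-tabulate g)) (concat⁺ (tabulate⁺ hops))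

occurs-block : ∀ {k L} (g : Fin k → List (Factor A)) → (∀ i → length (expandAll (g i)) ≡ L) →
  ∀ i → OccursAt (expandAll (g i)) (L * toℕ i) (expandAll (concat (tabulate g)))
occurs-block g len i =
  subst (OccursAt _ _) (sym (expandAll-concat-tabulate g)) (occurs-concat-tabulate (expandAll ∘ g) len i)

AllValid-++ʳ : ∀ {Z : List (A × ℕ)} {o} (T : List (A × ℕ)) fs → AllValid Z o fs → AllValid (Z ++ T) o fs
AllValid-++ʳ T []       _                          = tt
AllValid-++ʳ T (f ∷ fs) ((occurs , ends-before) , valid) =
  (occurs-++ʳ T occurs , ends-before) , AllValid-++ʳ T fs valid

AllValid-++ : ∀ {Z : List (A × ℕ)} {o} (fs gs : List (Factor A)) → AllValid Z o fs →
  AllValid Z (o + length (expandAll fs)) gs → AllValid Z o (fs ++ gs)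
AllValid-++ []       gs _ valid-gs = subst (λ i → AllValid _ i gs) (+-identityʳ _) valid-gs
AllValid-++ {Z = Z} {o} (f ∷ fs) gs (valid , valid-fs) valid-gs =
  valid , AllValid-++ fs gs valid-fs (subst (λ i → AllValid Z i gs) shift valid-gs)
  where
  shift : o + length (expand f ++ expandAll fs) ≡ size f + o + length (expandAll fs)
  shift = begin
    o + length (expand f ++ expandAll fs)           ≡⟨ cong (o +_) (length-++ (expand f)) ⟩
    o + (length (expand f) + length (expandAll fs)) ≡⟨ cong (λ x → o + (x + length (expandAll fs))) (length-expand f) ⟩
    o + (size f + length (expandAll fs))            ≡⟨ sym (+-assoc o (size f) _) ⟩
    o + size f + length (expandAll fs)              ≡⟨ cong (_+ length (expandAll fs)) (+-comm o (size f)) ⟩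
    size f + o + length (expandAll fs)              ∎
    where open ≡-Reasoning

AllValid-concat-tabulate : ∀ {Z : List (A × ℕ)} {k L} o (g : Fin k → List (Factor A)) →
  (∀ i → length (expandAll (g i)) ≡ L) → (∀ i → AllValid Z (o + L * toℕ i) (g i)) →
  AllValid Z o (concat (tabulate g))
AllValid-concat-tabulate {k = zero}          o g len valid = tt
AllValid-concat-tabulate {Z = Z} {suc k} {L} o g len valid =
  AllValid-++ (g zero) _
    (subst (λ i → AllValid Z i (g zero)) (trans (cong (o +_) (*-zeroʳ L)) (+-identityʳ o)) (valid zero))
    (AllValid-concat-tabulate _ (g ∘ suc) (len ∘ suc)
      (λ i → subst (λ x → AllValid Z x (g (suc i))) (shift i) (valid (suc i))))
  where
  shift : ∀ i → o + L * suc (toℕ i) ≡ o + length (expandAll (g zero)) + L * toℕ i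
  shift i = begin
    o + L * suc (toℕ i)                         ≡⟨ cong (o +_) (*-suc L (toℕ i)) ⟩
    o + (L + L * toℕ i)                         ≡⟨ sym (+-assoc o L _) ⟩
    o + L + L * toℕ i                           ≡⟨ cong (λ x → o + x + L * toℕ i) (sym (len zero)) ⟩
    o + length (expandAll (g zero)) + L * toℕ i ∎
    where open ≡-Reasoning

copies : List (A × ℕ) → (I → A) → List I → List (Factor A)
copies Z sep = map (λ γ → factor Z (sep γ) 0)

symbols-copies : ∀ (Z : List (A × ℕ)) (sep : I → A) γs →
  symbols (copies Z sep γs) ≡ concat (map (λ γ → map proj₁ Z ++ [ sep γ ]) γs)
symbols-copies Z sep []       = refl
symbols-copies Z sep (γ ∷ γs) = begin
  map proj₁ (expand f ++ rest)                      ≡⟨ map-++ proj₁ (expand f) rest ⟩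
  map proj₁ (expand f) ++ map proj₁ rest            ≡⟨ cong (_++ map proj₁ rest) (map-++ proj₁ (map (map₂ suc) Z) _) ⟩
  (map proj₁ (map (map₂ suc) Z) ++ [ sep γ ]) ++ map proj₁ rest
    ≡⟨ cong₂ (λ u w → (u ++ [ sep γ ]) ++ w) (sym (map-∘ Z)) (symbols-copies Z sep γs) ⟩
  (map proj₁ Z ++ [ sep γ ]) ++ concat (map (λ γ → map proj₁ Z ++ [ sep γ ]) γs) ∎
  where
  open ≡-Reasoning
  f = factor Z (sep γ) 0
  rest = expandAll (copies Z sep γs)

hops-copies : ∀ {c} (Z : List (A × ℕ)) (sep : I → A) γs → HopsAtMost c Z →
  HopsAtMost (suc c) (expandAll (copies Z sep γs))
hops-copies Z sep []       hops = []
hops-copies Z sep (γ ∷ γs) hops = ++⁺ (++⁺ (map⁺ (All.map s≤s hops)) (z≤n ∷ [])) (hops-copies Z sep γs hops)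

valid-copies : ∀ {o} (Z T : List (A × ℕ)) (sep : I → A) γs → length Z ≤ o →
  AllValid (Z ++ T) o (copies Z sep γs)
valid-copies Z T sep []       Z≤o = tt
valid-copies Z T sep (γ ∷ γs) Z≤o =
    (occurs-here Z T , subst (_≤ _) (sym (+-identityʳ (length Z))) Z≤o)
  , valid-copies Z T sep γs (≤-trans Z≤o (m≤n+m _ _))

module Reduction {n m : ℕ} (G : Graph n m) (ℓ : ℕ) (C : Subset n) where
  open Construction G ℓ

  fresh : Sym → Factor Sym
  fresh x = factor [] x 0

  plain : Sym → Sym × ℕ
  plain x = x , 0

  v v′ : Fin n → Sym
  v  = vtx ∘ toℕ
  v′ = vtx' ∘ toℕ

  e dollar : Fin m → Sym
  e      = edg ∘ toℕ
  dollar = dol ∘ toℕ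

  p q : Fin m → Fin n
  p j = proj₁ (edge G j)
  q j = proj₂ (edge G j)

  P-vertex : Fin n → List (Factor Sym)
  P-vertex i = fresh (v i) ∷ fresh (hashP (toℕ i)) ∷ []

  P-edge : Fin m → List (Factor Sym)
  P-edge j = fresh (e j) ∷ fresh (hashP (n + toℕ j)) ∷ []

  FPv FPe FP : List (Factor Sym)
  FPv = concat (tabulate P-vertex)
  FPe = concat (tabulate P-edge)
  FP  = FPv ++ FPe

  -- X_i is parsed as v_i' | v_i | #ᵛ_i for i ∈ C and as v_i' | v_i #ᵛ_i (v_i copied from P) otherwise,
  -- so v_i' v_i occurs with hop-numbers 0 exactly for i ∈ C. For e_j = (v_p , v_q), Y_j is parsed as
  -- v_p' v_p e_j | $_j | v_q' v_q | e_j $_j #ᵉ_j if p ∈ C, and as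
  -- v_p' v_p | e_j $_j | v_q' v_q e_j | $_j #ᵉ_j otherwise, in which case q ∈ C.
  X-block : Bool → Fin n → List (Factor Sym)
  X-block true  i = fresh (v′ i) ∷ fresh (v i) ∷ fresh (hashV (toℕ i)) ∷ []
  X-block false i = fresh (v′ i) ∷ factor [ plain (v i) ] (hashV (toℕ i)) (2 * toℕ i) ∷ []

  FX : List (Factor Sym)
  FX = concat (tabulate (λ i → X-block (lookup C i) i))

  ZPv ZP ZX : List (Sym × ℕ)
  ZPv = expandAll FPv
  ZP  = expandAll FP
  ZX  = expandAll FX

  xOffset : Fin n → ℕ
  xOffset i = length ZP + 3 * toℕ i

  yOffset : Fin m → ℕ
  yOffset j = length ZP + length ZX + 9 * toℕ j

  Y-block : Fin m → Bool → List (Factor Sym)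
  Y-block j true =
      factor (plain (v′ (p j)) ∷ plain (v (p j)) ∷ []) (e j) (xOffset (p j))
    ∷ fresh (dollar j)
    ∷ factor [ plain (v′ (q j)) ] (v (q j)) (xOffset (q j))
    ∷ factor (plain (e j) ∷ plain (dollar j) ∷ []) (hashE (toℕ j)) (2 + yOffset j)
    ∷ []
  Y-block j false =
      factor [ plain (v′ (p j)) ] (v (p j)) (xOffset (p j))
    ∷ factor [ plain (e j) ] (dollar j) (length ZPv + 2 * toℕ j)
    ∷ factor (plain (v′ (q j)) ∷ plain (v (q j)) ∷ []) (e j) (xOffset (q j))
    ∷ factor [ plain (dollar j) ] (hashE (toℕ j)) (3 + yOffset j)
    ∷ []

  FY F1 : List (Factor Sym)
  FY = concat (tabulate (λ j → Y-block j (lookup C (p j))))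
  F1 = FP ++ FX ++ FY

  ZY Z1 : List (Sym × ℕ)
  ZY = expandAll FY
  Z1 = expandAll F1

  Z1-split : Z1 ≡ ZP ++ ZX ++ ZY
  Z1-split = trans (expandAll-++ FP _) (cong (ZP ++_) (expandAll-++ FX FY))

  Z1-split-after-X : Z1 ≡ (ZP ++ ZX) ++ ZY
  Z1-split-after-X = trans Z1-split (sym (++-assoc ZP ZX ZY))

  X-size : ∀ b i → length (expandAll (X-block b i)) ≡ 3
  X-size true  i = refl
  X-size false i = refl

  Y-size : ∀ j b → length (expandAll (Y-block j b)) ≡ 9
  Y-size j true  = refl
  Y-size j false = refl

  vertex-occurs : ∀ i → OccursAt [ plain (v i) ] (2 * toℕ i) ZP
  vertex-occurs i = subst (OccursAt _ _) (sym (expandAll-++ FPv FPe))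
    (occurs-++ʳ _ (occurs-trans (occurs-block P-vertex (λ _ → refl) i) (occurs-here _ _)))

  edge-occurs : ∀ j → OccursAt [ plain (e j) ] (length ZPv + 2 * toℕ j) ZP
  edge-occurs j = subst (OccursAt _ _) (sym (expandAll-++ FPv FPe))
    (occurs-++ˡ ZPv (occurs-trans (occurs-block P-edge (λ _ → refl) j) (occurs-here _ _)))

  X-occurs : ∀ i → OccursAt (expandAll (X-block (lookup C i) i)) (xOffset i) (ZP ++ ZX)
  X-occurs i = occurs-++ˡ ZP (occurs-block _ (λ i → X-size (lookup C i) i) i)

  primed-occurs : ∀ i → OccursAt [ plain (v′ i) ] (xOffset i) (ZP ++ ZX)
  primed-occurs i = occurs-trans (X-occurs i) (X-head (lookup C i))
    where
    X-head : ∀ b → OccursAt [ plain (v′ i) ] 0 (expandAll (X-block b i))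
    X-head true  = occurs-here _ _
    X-head false = occurs-here _ _

  covered-occurs : ∀ i → lookup C i ≡ true → OccursAt (plain (v′ i) ∷ plain (v i) ∷ []) (xOffset i) (ZP ++ ZX)
  covered-occurs i i∈C = occurs-trans
    (subst (λ b → OccursAt (expandAll (X-block b i)) (xOffset i) (ZP ++ ZX)) i∈C (X-occurs i))
    (occurs-here _ _)

  Y-occurs : ∀ j → OccursAt (expandAll (Y-block j (lookup C (p j)))) (yOffset j) Z1
  Y-occurs j = subst₂ (OccursAt _) (cong (_+ 9 * toℕ j) (length-++ ZP)) (sym Z1-split-after-X)
    (occurs-++ˡ (ZP ++ ZX) (occurs-block _ (λ j → Y-size j (lookup C (p j))) j))

  PX-before-Y : ∀ j r → length (ZP ++ ZX) ≤ r + yOffset j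
  PX-before-Y j r = ≤-trans (≤-reflexive (length-++ ZP)) (≤-trans (m≤m+n _ (9 * toℕ j)) (m≤n+m _ r))

  second-covered : (∀ j → p j ∈ C ⊎ q j ∈ C) → ∀ j → lookup C (p j) ≡ false → lookup C (q j) ≡ true
  second-covered cover j p∉C with cover j
  ... | inj₂ q∈C = []=⇒lookup q∈C
  ... | inj₁ p∈C with trans (sym ([]=⇒lookup p∈C)) p∉C
  ...   | ()

  X-valid : ∀ b i → AllValid Z1 (xOffset i) (X-block b i)
  X-valid true  i = []-occursBefore , []-occursBefore , []-occursBefore , tt
  X-valid false i = []-occursBefore , occursBefore-prefix Z1-split (vertex-occurs i) (m≤n⇒m≤1+n (m≤m+n _ _)) , tt

  Y-valid : (∀ j → p j ∈ C ⊎ q j ∈ C) → ∀ j → AllValid Z1 (yOffset j) (Y-block j (lookup C (p j)))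
  Y-valid cover j with lookup C (p j) in p-side | Y-occurs j
  ... | true  | placed =
        occursBefore-prefix Z1-split-after-X (covered-occurs (p j) p-side) (PX-before-Y j 0)
      , []-occursBefore
      , occursBefore-prefix Z1-split-after-X (primed-occurs (q j)) (PX-before-Y j 4)
      , (occurs-trans placed (_ ∷ _ ∷ [] , _ , refl , refl) , m≤n+m _ 2)
      , tt
  ... | false | placed =
        occursBefore-prefix Z1-split-after-X (primed-occurs (p j)) (PX-before-Y j 0)
      , occursBefore-prefix Z1-split-after-X (occurs-++ʳ ZX (edge-occurs j)) (PX-before-Y j 2)
      , occursBefore-prefix Z1-split-after-X (covered-occurs (q j) (second-covered cover j p-side)) (PX-before-Y j 4)
      , (occurs-trans placed (_ ∷ _ ∷ _ ∷ [] , _ , refl , refl) , m≤n+m _ 3)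
      , tt

  F1-valid : (∀ j → p j ∈ C ⊎ q j ∈ C) → AllValid Z1 0 F1
  F1-valid cover =
    AllValid-++ FP (FX ++ FY)
      (AllValid-++ FPv FPe
        (AllValid-concat-tabulate _ P-vertex (λ _ → refl) (λ _ → []-occursBefore , []-occursBefore , tt))
        (AllValid-concat-tabulate _ P-edge (λ _ → refl) (λ _ → []-occursBefore , []-occursBefore , tt)))
      (AllValid-++ FX FY
        (AllValid-concat-tabulate _ _ (λ i → X-size (lookup C i) i) (λ i → X-valid (lookup C i) i))
        (AllValid-concat-tabulate _ _ (λ j → Y-size j (lookup C (p j))) (Y-valid cover)))

  X-hops : ∀ b i → HopsAtMost 1 (expandAll (X-block b i))
  X-hops true  i = z≤n ∷ z≤n ∷ z≤n ∷ []
  X-hops false i = z≤n ∷ s≤s z≤n ∷ z≤n ∷ []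

  Y-hops : ∀ j b → HopsAtMost 1 (expandAll (Y-block j b))
  Y-hops j true  = s≤s z≤n ∷ s≤s z≤n ∷ z≤n ∷ z≤n ∷ s≤s z≤n ∷ z≤n ∷ s≤s z≤n ∷ s≤s z≤n ∷ z≤n ∷ []
  Y-hops j false = s≤s z≤n ∷ z≤n ∷ s≤s z≤n ∷ z≤n ∷ s≤s z≤n ∷ s≤s z≤n ∷ z≤n ∷ s≤s z≤n ∷ z≤n ∷ []

  F1-hops : HopsAtMost 1 Z1
  F1-hops = subst (HopsAtMost 1) (sym Z1-split) (++⁺ P-hops (++⁺
    (hops-concat-tabulate _ (λ i → X-hops (lookup C i) i))
    (hops-concat-tabulate _ (λ j → Y-hops j (lookup C (p j))))))
    where
    P-hops : HopsAtMost 1 ZP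
    P-hops = subst (HopsAtMost 1) (sym (expandAll-++ FPv FPe)) (++⁺
      (hops-concat-tabulate P-vertex (λ _ → z≤n ∷ z≤n ∷ []))
      (hops-concat-tabulate P-edge (λ _ → z≤n ∷ z≤n ∷ [])))

  X-symbols : ∀ b i → symbols (X-block b i) ≡ v′ i ∷ v i ∷ hashV (toℕ i) ∷ []
  X-symbols true  i = refl
  X-symbols false i = refl

  Y-symbols : ∀ j b → symbols (Y-block j b) ≡ Ystr-i j
  Y-symbols j true  = refl
  Y-symbols j false = refl

  F1-symbols : symbols F1 ≡ alpha 1
  F1-symbols = begin
    symbols (FP ++ FX ++ FY)                    ≡⟨ symbols-++ FP _ ⟩
    symbols FP ++ symbols (FX ++ FY)            ≡⟨ cong₂ _++_ P-symbols (symbols-++ FX FY) ⟩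
    Pstr ++ symbols FX ++ symbols FY            ≡⟨ cong (Pstr ++_) (cong₂ _++_
                                                     (symbols-concat-tabulate _ _ (λ i → X-symbols (lookup C i) i))
                                                     (symbols-concat-tabulate _ _ (λ j → Y-symbols j (lookup C (p j))))) ⟩
    Pstr ++ Xstr ++ Ystr                        ∎
    where
    open ≡-Reasoning
    P-symbols : symbols FP ≡ Pstr
    P-symbols = trans (symbols-++ FPv FPe) (cong₂ _++_
      (symbols-concat-tabulate P-vertex _ (λ _ → refl)) (symbols-concat-tabulate P-edge _ (λ _ → refl)))

  F1-length : length F1 ≡ 4 * n + 6 * m + ∣ C ∣
  F1-length = begin
    length (FP ++ FX ++ FY)                                   ≡⟨ length-++ FP ⟩
    length FP + length (FX ++ FY)                             ≡⟨ cong₂ _+_ (length-++ FPv) (length-++ FX) ⟩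
    length FPv + length FPe + (length FX + length FY)         ≡⟨ cong₂ _+_
        (cong₂ _+_ (length-concat-tabulate P-vertex (λ _ → refl)) (length-concat-tabulate P-edge (λ _ → refl)))
        (cong₂ _+_ (length-concat-tabulate-subset C X-block (λ _ → refl) (λ _ → refl))
                   (length-concat-tabulate _ (λ j → Y-count j (lookup C (p j))))) ⟩
    2 * n + 2 * m + (2 * n + ∣ C ∣ + 4 * m)                   ≡⟨ arith n m ∣ C ∣ ⟩
    4 * n + 6 * m + ∣ C ∣                                     ∎
    where
    open ≡-Reasoning
    Y-count : ∀ j b → length (Y-block j b) ≡ 4
    Y-count j true  = refl
    Y-count j false = refl
    arith : ∀ n m k → 2 * n + 2 * m + (2 * n + k + 4 * m) ≡ 4 * n + 6 * m + k
    arith = solve-∀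

  β-factors : ℕ → List (Factor Sym) → List (Factor Sym)
  β-factors i fs = copies (expandAll fs) (hashL i) (map suc (upTo ℓ))

  factors : ℕ → List (Factor Sym)
  factors zero    = F1
  factors (suc i) = factors i ++ β-factors (suc i) (factors i)

  factors-symbols : ∀ i → symbols (factors i) ≡ alpha (suc i)
  factors-symbols zero    = F1-symbols
  factors-symbols (suc i) = trans (symbols-++ (factors i) (β-factors (suc i) (factors i)))
    (cong₂ _++_ (factors-symbols i)
      (trans (symbols-copies (expandAll (factors i)) (hashL (suc i)) (map suc (upTo ℓ)))
             (cong (betaOf (suc i)) (factors-symbols i))))

  factors-hops : ∀ i → HopsAtMost (suc i) (expandAll (factors i))
  factors-hops zero    = F1-hops
  factors-hops (suc i) =
    subst (HopsAtMost (suc (suc i))) (sym (expandAll-++ (factors i) (β-factors (suc i) (factors i))))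
      (++⁺ (All.map m≤n⇒m≤1+n (factors-hops i))
           (hops-copies (expandAll (factors i)) (hashL (suc i)) (map suc (upTo ℓ)) (factors-hops i)))

  factors-valid : (∀ j → p j ∈ C ⊎ q j ∈ C) → ∀ i → AllValid (expandAll (factors i)) 0 (factors i)
  factors-valid cover zero    = F1-valid cover
  factors-valid cover (suc i) =
    subst (λ Z → AllValid Z 0 (factors (suc i))) (sym (expandAll-++ (factors i) separated))
      (AllValid-++ (factors i) separated
        (AllValid-++ʳ (expandAll separated) (factors i) (factors-valid cover i))
        (valid-copies (expandAll (factors i)) (expandAll separated) (hashL (suc i)) (map suc (upTo ℓ)) ≤-refl))
    where separated = β-factors (suc i) (factors i)

  factors-length : ∀ i → length (factors i) ≡ 4 * n + 6 * m + ∣ C ∣ + i * ℓ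
  factors-length zero    = trans F1-length (sym (+-identityʳ _))
  factors-length (suc i) = begin
    length (factors i ++ separated)       ≡⟨ length-++ (factors i) ⟩
    length (factors i) + length separated ≡⟨ cong₂ _+_ (factors-length i) separated-length ⟩
    a + i * ℓ + ℓ                         ≡⟨ +-assoc a (i * ℓ) ℓ ⟩
    a + (i * ℓ + ℓ)                       ≡⟨ cong (a +_) (+-comm (i * ℓ) ℓ) ⟩
    a + suc i * ℓ                         ∎
    where
    open ≡-Reasoning
    a = 4 * n + 6 * m + ∣ C ∣
    separated = β-factors (suc i) (factors i)
    separated-length : length separated ≡ ℓ
    separated-length = trans (length-map _ (map suc (upTo ℓ))) (trans (length-map suc (upTo ℓ)) (length-upTo ℓ))

-- The hypotheses k ≤ n and k < ℓ are only needed for the converse direction of the reduction.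
lemma2 : (n m : ℕ) (G : Graph n m) (c k ℓ : ℕ) →
    1 ≤ c → k ≤ n → k < ℓ → HasVertexCover G k →
    Σ (List Phrase) (λ ps → IsBLZParsing c (sG G c ℓ) ps ×
    length ps ≡ 4 * n + 6 * m + k + (c ∸ 1) * ℓ)
lemma2 n m G (suc c) k ℓ _ _ _ (C , ∣C∣≡k , cover) =
    map toPhrase (factors c)
  , subst (λ s → IsBLZParsing (suc c) s (map toPhrase (factors c))) (factors-symbols c)
      (isBLZParsing (suc c) (factors c) (factors-valid cover c) (factors-hops c))
  , trans (length-map toPhrase (factors c))
      (trans (factors-length c) (cong (λ x → 4 * n + 6 * m + x + c * ℓ) ∣C∣≡k))
  where open Reduction G ℓ C
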